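{- Let $Q$ and $R$ be two $\mathrm{TF}\Sigma_2^{dt}$ search problems. The following are equivalent: (i) there exists a weakening from $Q$ to $R$; (ii) for every $n$, $F_{R_n}$ is a $\Sigma_2$-weakening of $F_{Q_n}$.
   Context: A $\mathrm{TF}\Sigma_2^{dt}$ problem $R$ is a sequence of relations $R_m\subseteq\{0,1\}^m\times\mathcal{O}^R_m\times\mathcal{W}^R_m$ where each predicate $a\mapsto R_m(a,b;c)$ is computed by a decision tree $R_{m,b,c}$ of depth $\mathrm{polylog}(m)$; $b$ is a solution for $a$ if $R_m(a,b;c)$ holds for all $c\in\mathcal{W}^R_m$, and every input has a solution. For a decision tree $T$, $\overline{T}$ is the DNF whose terms are the rejecting paths of $T$. The formula $F_{R_m}$ is the collection of DNFs $\bigvee_{c\in\mathcal{W}^R_m}\overline{R}_{m,b,c}$, one for each $b\in\mathcal{O}^R_m$. An $R$-formulation of $Q$ of size $s(n)$ consists of $f=(f_1,\dots,f_{s(n)})$, $f_i:\{0,1\}^n\to\{0,1\}$, and $g_b:\{0,1\}^n\to\mathcal{O}^Q_n$ for $b\in\mathcal{O}^R_{s(n)}$, such that whenever $b$ is a solution of $R_{s(n)}$ for $f(x)$, $g_b(x)$ is a solution of $Q_n$ for $x$. Such an $(f,g)$ is a weakening (from $Q$ to $R$) if $f$ is the identity (so $s(n)=n$) and each $g_b$ is a constant function. A $\Sigma_2$-weakening of a DNF $D$ is a collection of DNFs each implied by $D$; a $\Sigma_2$-weakening of a collection of DNFs is a collection of $\Sigma_2$-weakenings of those DNFs (every DNF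 in it is implied by some DNF of the original collection). -}

module Defs where

open import Data.Nat using (ℕ; zero; suc; _+_; _*_; _^_; _≤_; _⊔_)
open import Data.Nat.Logarithm using (⌈log₂_⌉)
open import Data.Bool using (Bool; true; false)
open import Data.Fin using (Fin)
open import Data.List using (List; []; _∷_; _++_; map; concatMap; [_])
open import Data.List.Relation.Unary.All using (All)
open import Data.List.Relation.Unary.Any using (Any)
open import Data.Product using (Σ; ∃; _×_; _,_)
open import Relation.Binary.PropositionalEquality using (_≡_)
open import Data.Fin using (Fin)


Input : ℕ → Set
Input m = Fin m → Bool

data DT (m : ℕ) : Set where
  leaf : Bool → DT m
  node : Fin m → DT m → DT m → DT m

eval : ∀ {m} → DT m → Input m → Bool
eval (leaf v) x = v
eval (node i l r) x with x i
... | false = eval l x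
... | true  = eval r x

depth : ∀ {m} → DT m → ℕ
depth (leaf _) = 0
depth (node _ l r) = suc (depth l ⊔ depth r)

Literal : ℕ → Set
Literal m = Fin m × Bool

Term : ℕ → Set
Term m = List (Literal m)

DNF : ℕ → Set
DNF m = List (Term m)

_⊨L_ : ∀ {m} → Input m → Literal m → Set
x ⊨L (i , v) = x i ≡ v

_⊨T_ : ∀ {m} → Input m → Term m → Set
x ⊨T t = All (x ⊨L_) t

_⊨_ : ∀ {m} → Input m → DNF m → Set
x ⊨ D = Any (x ⊨T_) D

_⇒DNF_ : ∀ {m} → DNF m → DNF m → Set
D ⇒DNF D' = ∀ x → x ⊨ D → x ⊨ D'

-- T̄ : the DNF whose terms are the rejecting paths of T
reject : ∀ {m} → DT m → DNF m
reject (leaf true)  = []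
reject (leaf false) = [ [] ]
reject (node i l r) =
  map ((i , false) ∷_) (reject l) ++ map ((i , true) ∷_) (reject r)

Collection : ℕ → Set
Collection m = Σ ℕ (λ k → Fin k → DNF m)

IsΣ₂Weakening : ∀ {m} → Collection m → Collection m → Set
IsΣ₂Weakening (k , G) (l , F) = ∀ (j : Fin k) → ∃ λ (i : Fin l) → F i ⇒DNF G j

-- TFΣ₂^dt problem: for each m, solution set 𝒪_m = Fin (O m), witness set
-- 𝒲_m = Fin (W m), and decision trees R_{m,b,c} computing a ↦ R_m(a,b;c),
-- of depth polylog(m), such that every input has a solution.
record TFΣ₂dt : Set where
  field
    O : ℕ → ℕ
    W : ℕ → ℕ
    tree : (m : ℕ) → Fin (O m) → Fin (W m) → DT m

  IsSolution : (m : ℕ) → Input m → Fin (O m) → Set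
  IsSolution m a b = ∀ (c : Fin (W m)) → eval (tree m b c) a ≡ true

  field
    -- depth polylog(m): ≤ k · (⌈log₂ m⌉ + 1)^k for some constant k
    polylogDepth : ∃ λ (k : ℕ) → ∀ m b c → depth (tree m b c) ≤ k * (⌈log₂ m ⌉ + 1) ^ k
    total : ∀ m (a : Input m) → ∃ λ (b : Fin (O m)) → IsSolution m a b

open TFΣ₂dt public

allFinL : (n : ℕ) → List (Fin n)
allFinL n = Data.List.allFin n

-- F_{R_m}: for each b, the DNF ⋁_{c} R̄_{m,b,c}
F : (R : TFΣ₂dt) → (m : ℕ) → Collection m
F R m = O R m , λ b → concatMap (λ c → reject (tree R m b c)) (allFinL (W R m))

-- weakening from Q to R: f = identity, each g_b constant
Weakening : TFΣ₂dt → TFΣ₂dt → Set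
Weakening Q R =
  Σ ((n : ℕ) → Fin (O R n) → Fin (O Q n)) λ g →
    ∀ n (x : Input n) (b : Fin (O R n)) → IsSolution R n x b → IsSolution Q n x (g n b)

{-# OPTIONS --safe #-}
-- An input x satisfies the b-th DNF of F_P exactly when some decision tree
-- R_{b,c} rejects x, i.e. when b is not a solution for x.  So F_Q (g b) ⇒ F_R b
-- is the contrapositive of "b solves R ⇒ g b solves Q", and the two are
-- equivalent because being a solution is decidable (finitely many witnesses,
-- Boolean leaves).  A Σ₂-weakening then supplies g b, and conversely.
module Submission where

open import Defs
open import Data.Bool using (true; false; _≟_)
open import Data.Bool.Properties using (¬-not)
open import Data.Fin using (Fin)
open import Data.Fin.Properties using (all?; ¬∀⟶∃¬)
open import Data.List using (_∷_; map)
open import Data.List.Membership.Propositional using (lose)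
open import Data.List.Membership.Propositional.Properties using (∈-allFin)
import Data.List.Relation.Unary.All as All
open import Data.List.Relation.Unary.Any as Any using (here; satisfied)
open import Data.List.Relation.Unary.Any.Properties using (++⁻; ++⁺ˡ; ++⁺ʳ; map⁺; map⁻; concatMap⁺; concatMap⁻)
open import Data.Nat using (ℕ)
open import Data.Product using (_×_; _,_; proj₁; proj₂; ∃)
open import Data.Sum using (inj₁; inj₂)
open import Function using (_∘_; _⇔_; mk⇔; Equivalence)
open import Relation.Binary.PropositionalEquality using (_≡_; refl; trans; sym)
open import Relation.Nullary using (¬_; Dec)
open import Relation.Nullary.Decidable using (decidable-stable)

open Equivalence using (to; from)

module _ {m : ℕ} {x : Input m} where

  ⊨-prefix⁻ : ∀ {l : Literal m} (D : DNF m) → x ⊨ map (l ∷_) D → x ⊨L l × x ⊨ D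
  ⊨-prefix⁻ D p = All.head (proj₂ (satisfied (map⁻ p))) , Any.map All.tail (map⁻ p)

  ⊨-prefix⁺ : ∀ {l : Literal m} {D : DNF m} → x ⊨L l → x ⊨ D → x ⊨ map (l ∷_) D
  ⊨-prefix⁺ xl = map⁺ ∘ Any.map (xl All.∷_)

  ⊨-reject⁻ : (T : DT m) → x ⊨ reject T → eval T x ≡ false
  ⊨-reject⁻ (leaf false) _ = refl
  ⊨-reject⁻ (node i l r) p with ++⁻ (map ((i , false) ∷_) (reject l)) p
  ... | inj₁ p-l with ⊨-prefix⁻ (reject l) p-l
  ...   | xi≡false , x⊨l rewrite xi≡false = ⊨-reject⁻ l x⊨l
  ⊨-reject⁻ (node i l r) p | inj₂ p-r with ⊨-prefix⁻ (reject r) p-r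
  ...   | xi≡true , x⊨r rewrite xi≡true = ⊨-reject⁻ r x⊨r

  ⊨-reject⁺ : (T : DT m) → eval T x ≡ false → x ⊨ reject T
  ⊨-reject⁺ (leaf false) _ = here All.[]
  ⊨-reject⁺ (node i l r) rejects with x i in xi
  ... | false = ++⁺ˡ (⊨-prefix⁺ xi (⊨-reject⁺ l rejects))
  ... | true  = ++⁺ʳ (map ((i , false) ∷_) (reject l)) (⊨-prefix⁺ xi (⊨-reject⁺ r rejects))

module _ (P : TFΣ₂dt) (n : ℕ) (x : Input n) (b : Fin (O P n)) where

  Rejected : Set
  Rejected = ∃ λ c → eval (tree P n b c) x ≡ false

  ⊨F⇔Rejected : x ⊨ proj₂ (F P n) b ⇔ Rejected
  ⊨F⇔Rejected = mk⇔ to′ from′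
    where
    rejectingPaths : Fin (W P n) → DNF n
    rejectingPaths c = reject (tree P n b c)

    to′ : x ⊨ proj₂ (F P n) b → Rejected
    to′ p with satisfied (concatMap⁻ rejectingPaths {xs = allFinL (W P n)} p)
    ... | c , x⊨c = c , ⊨-reject⁻ (tree P n b c) x⊨c

    from′ : Rejected → x ⊨ proj₂ (F P n) b
    from′ (c , rejects) = concatMap⁺ rejectingPaths (lose (∈-allFin c) (⊨-reject⁺ (tree P n b c) rejects))

  isSolution? : Dec (IsSolution P n x b)
  isSolution? = all? (λ c → eval (tree P n b c) x ≟ true)

  ¬IsSolution⇔Rejected : (¬ IsSolution P n x b) ⇔ Rejected
  ¬IsSolution⇔Rejected = mk⇔ to′ from′
    where
    to′ : ¬ IsSolution P n x b → Rejected
    to′ ¬sol with ¬∀⟶∃¬ (W P n) _ (λ c → eval (tree P n b c) x ≟ true) ¬sol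
    ... | c , ¬accepts = c , ¬-not ¬accepts

    from′ : Rejected → ¬ IsSolution P n x b
    from′ (c , rejects) sol with trans (sym (sol c)) rejects
    ... | ()

  ⊨F⇔¬IsSolution : x ⊨ proj₂ (F P n) b ⇔ (¬ IsSolution P n x b)
  ⊨F⇔¬IsSolution = mk⇔ (from ¬IsSolution⇔Rejected ∘ to ⊨F⇔Rejected)
                       (from ⊨F⇔Rejected ∘ to ¬IsSolution⇔Rejected)

module _ (Q R : TFΣ₂dt) (n : ℕ) (b : Fin (O R n)) (b′ : Fin (O Q n)) where

  IsSolution⊆⇔F⇒DNF : (∀ x → IsSolution R n x b → IsSolution Q n x b′)
                     ⇔ (proj₂ (F Q n) b′ ⇒DNF proj₂ (F R n) b)
  IsSolution⊆⇔F⇒DNF = mk⇔ to′ from′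
    where
    to′ : (∀ x → IsSolution R n x b → IsSolution Q n x b′) → proj₂ (F Q n) b′ ⇒DNF proj₂ (F R n) b
    to′ sol⊆ x x⊨Q = from (⊨F⇔¬IsSolution R n x b)
      (to (⊨F⇔¬IsSolution Q n x b′) x⊨Q ∘ sol⊆ x)

    from′ : proj₂ (F Q n) b′ ⇒DNF proj₂ (F R n) b → ∀ x → IsSolution R n x b → IsSolution Q n x b′
    from′ Q⇒R x solR = decidable-stable (isSolution? Q n x b′) λ ¬solQ →
      to (⊨F⇔¬IsSolution R n x b) (Q⇒R x (from (⊨F⇔¬IsSolution Q n x b′) ¬solQ)) solR

proposition5p5 : (Q R : TFΣ₂dt) → (Weakening Q R → (∀ n → IsΣ₂Weakening (F R n) (F Q n))) × ((∀ n → IsΣ₂Weakening (F R n) (F Q n)) → Weakening Q R)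
proposition5p5 Q R = weakening⇒Σ₂ , Σ₂⇒weakening
  where
  weakening⇒Σ₂ : Weakening Q R → ∀ n → IsΣ₂Weakening (F R n) (F Q n)
  weakening⇒Σ₂ (g , g-sound) n b =
    g n b , to (IsSolution⊆⇔F⇒DNF Q R n b (g n b)) (λ x → g-sound n x b)

  Σ₂⇒weakening : (∀ n → IsΣ₂Weakening (F R n) (F Q n)) → Weakening Q R
  Σ₂⇒weakening w = (λ n b → proj₁ (w n b)) , λ n x b →
    from (IsSolution⊆⇔F⇒DNF Q R n b (proj₁ (w n b))) (proj₂ (w n b)) x
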